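{- Let $S$ be a set of positive integers and $k$ a field of characteristic zero. Then for every $n \ge 0$, $M_S(n) = \dim_k h(k[S]_n)$.
   Context: $M_S(n)$ is the number of distinct values of $n!/\prod_{j} j!^{a_j}$ as $(a_j)_{j\in S}$ ranges over families of nonnegative integers (finitely many nonzero) with $\sum_{j\in S} j\,a_j = n$, i.e. the number of distinct multinomial coefficients with upper entry $n$ and all lower entries in $S$. $k[S]$ denotes the polynomial ring $k[q_j : j \in S]$, graded by $\deg q_j = j$, and $k[S]_n$ is the $k$-subspace of homogeneous polynomials of degree $n$ (with basis the monomials $\prod_j q_j^{a_j}$ with $\sum_j j a_j = n$). Let $k[x,q]$ be the polynomial ring over $k$ in variables $q$ and $x_p$ for $p$ prime. The $k$-algebra homomorphism $h: k[S]\to k[x,q]$ is defined by $h(q_j) = q^j \prod_{p \text{ prime}} x_p^{\sum_{l\ge 1}\lfloor j/p^l\rfloor}$ (so the $x$-part of $h(q_j)$ encodes the prime factorization of $j!$). -}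

module Defs where

open import Level using (Level; _⊔_) renaming (suc to lsuc)
open import Algebra.Bundles using (CommutativeRing)
open import Data.Bool using (Bool; true; false; _∧_; if_then_else_)
open import Data.Nat as ℕ using (ℕ; zero; suc; _<_; _≡ᵇ_; NonZero)
open import Data.Nat.Properties using (m^n≢0)
open import Data.Nat using (_!)
open import Data.Nat.Primality using (prime?)
open import Data.Nat.DivMod using (_/_)
open import Data.List using (List; []; _∷_; map; upTo; length; concat)
open import Data.List.Membership.Propositional using (_∈_)
open import Data.List.Relation.Unary.Unique.Propositional using (Unique)
open import Data.Fin using (Fin)
open import Data.List using (allFin)
open import Data.Product using (Σ; _×_; _,_)
open import Relation.Nullary using (¬_; does)
open import Relation.Binary.PropositionalEquality using (_≡_; _≢_)
open import Function.Bundles using (_⇔_)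

record Field (c ℓ : Level) : Set (lsuc (c ⊔ ℓ)) where
  field
    commutativeRing : CommutativeRing c ℓ
  open CommutativeRing commutativeRing public
  field
    1≉0     : ¬ (1# ≈ 0#)
    inverse : ∀ x → ¬ (x ≈ 0#) → Σ Carrier λ y → (x * y) ≈ 1#

module _ {c ℓ} (K : Field c ℓ) where
  open Field K

  natK : ℕ → Carrier
  natK zero    = 0#
  natK (suc n) = 1# + natK n

  CharZero : Set ℓ
  CharZero = ∀ n → ¬ (natK (suc n) ≈ 0#)

sumTo : ℕ → (ℕ → ℕ) → ℕ
sumTo zero    f = 0
sumTo (suc n) f = sumTo n f ℕ.+ f (suc n)

prodTo : ℕ → (ℕ → ℕ) → ℕ
prodTo zero    f = 1
prodTo (suc n) f = prodTo n f ℕ.* f (suc n)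

-- A family is a function a : ℕ → ℕ supported in S; since S consists of
-- positive integers and Σ j a_j = n, a_j = 0 for j > n (recorded
-- explicitly, so that the sum is the finite sum over 1 ≤ j ≤ n).

Comp : (S : ℕ → Set) → ℕ → Set
Comp S n = Σ (ℕ → ℕ) λ a →
             (∀ j → a j ≢ 0 → S j)
           × (∀ j → n < j → a j ≡ 0)
           × (sumTo n (λ j → j ℕ.* a j) ≡ n)

factProd : ℕ → (ℕ → ℕ) → ℕ
factProd n a = prodTo n (λ j → (j !) ℕ.^ a j)

-- c is a multinomial coefficient n! / ∏ j!^{a_j} with lower entries in S
-- (the division is exact, so c = n!/∏ j!^{a_j} iff c · ∏ j!^{a_j} = n!)
MultVal : (S : ℕ → Set) → ℕ → ℕ → Set
MultVal S n c = Σ (Comp S n) λ { (a , _) → c ℕ.* factProd n a ≡ n ! }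

-- M_S(n) = m : the set of values of the multinomial coefficients is
-- listed without repetition by a list of length m.
MCount : (S : ℕ → Set) → ℕ → ℕ → Set
MCount S n m = Σ (List ℕ) λ L →
                 (length L ≡ m) × Unique L × (∀ c → (c ∈ L) ⇔ MultVal S n c)

-- Monomials of k[x,q]: an exponent of q and a list of exponents of the
-- x_p (entry number p is the exponent of x_p), compared up to trailing
-- zeros (decidably).

record XMon : Set where
  constructor xmon
  field
    qexp  : ℕ
    xexps : List ℕ

isZero : ℕ → Bool
isZero n = n ≡ᵇ 0

allZero : List ℕ → Bool
allZero []       = true
allZero (x ∷ xs) = isZero x ∧ allZero xs

eqExps : List ℕ → List ℕ → Bool
eqExps []       ys       = allZero ys
eqExps (x ∷ xs) []       = allZero (x ∷ xs)
eqExps (x ∷ xs) (y ∷ ys) = (x ≡ᵇ y) ∧ eqExps xs ys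

eqMon : XMon → XMon → Bool
eqMon (xmon q xs) (xmon r ys) = (q ≡ᵇ r) ∧ eqExps xs ys

-- exponent of x_p in h(q_j):  Σ_{l ≥ 1} ⌊ j / p^l ⌋  for p prime, 0 for
-- p not prime.  Terms with l > j vanish (p^l ≥ 2^l > j), so the sum is
-- taken over 1 ≤ l ≤ j.
xExp : ℕ → ℕ → ℕ
xExp zero          j = 0
xExp (suc zero)    j = 0
xExp (suc (suc r)) j =
  if does (prime? p) then sumTo j (λ l → _/_ j (p ℕ.^ l) {{m^n≢0 p l}}) else 0
  where p = suc (suc r)

-- h on the monomial ∏_j q_j^{a_j} of degree n:
--   q^{Σ j a_j} ∏_p x_p^{Σ_j a_j · xExp p j}
-- (only primes p ≤ n can have nonzero exponent, the list stops at p = n)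
hMon : ℕ → (ℕ → ℕ) → XMon
hMon n a = xmon (sumTo n (λ j → j ℕ.* a j))
                (map (λ p → sumTo n (λ j → a j ℕ.* xExp p j)) (upTo (suc n)))

module _ {c ℓ} (K : Field c ℓ) where
  open Field K

  -- elements of k[x,q]: finite formal K-linear combinations of monomials
  Poly : Set c
  Poly = List (Carrier × XMon)

  coeff : Poly → XMon → Carrier
  coeff []              m = 0#
  coeff ((x , m') ∷ f) m = (if eqMon m' m then x else 0#) + coeff f m

  _≈P_ : Poly → Poly → Set ℓ
  f ≈P g = ∀ m → coeff f m ≈ coeff g m

  zeroP : Poly
  zeroP = []

  scale : Carrier → Poly → Poly
  scale x = map (λ { (y , m) → (x * y , m) })

  lincomb : ∀ {d} → (Fin d → Carrier) → (Fin d → Poly) → Poly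
  lincomb {d} cs bs = concat (map (λ i → scale (cs i) (bs i)) (allFin d))

  -- elements of k[S]_n: finite K-linear combinations of monomials
  -- ∏_{j ∈ S} q_j^{a_j} with Σ j a_j = n
  PolyS : (S : ℕ → Set) → ℕ → Set c
  PolyS S n = List (Carrier × Comp S n)

  h : ∀ {S n} → PolyS S n → Poly
  h {S} {n} = map (λ { (x , (a , _)) → (x , hMon n a) })

  InImage : (S : ℕ → Set) → ℕ → Poly → Set (c ⊔ ℓ)
  InImage S n f = Σ (PolyS S n) λ g → h g ≈P f

  LinIndep : ∀ {d} → (Fin d → Poly) → Set (c ⊔ ℓ)
  LinIndep {d} bs = ∀ cs → lincomb cs bs ≈P zeroP → ∀ i → cs i ≈ 0#

  DimImage : (S : ℕ → Set) → ℕ → ℕ → Set (c ⊔ ℓ)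
  DimImage S n d = Σ (Fin d → Poly) λ bs →
                     (∀ i → InImage S n (bs i))
                   × LinIndep bs
                   × (∀ f → InImage S n f → Σ (Fin d → Carrier) λ cs → lincomb cs bs ≈P f)

-- By Legendre's formula the exponent of x_p in h(∏ q_j^{a_j}) is the p-adic valuation of
-- ∏ j!^{a_j}, and the exponent of q is n. A positive integer is determined by its valuations,
-- so two monomials of k[S]_n have the same image under h exactly when they have the same
-- multinomial coefficient n!/∏ j!^{a_j}. One monomial for each value of the multinomial
-- coefficient therefore gives pairwise distinct monomials of k[x,q] forming a basis of h(k[S]_n).
-- Any other basis has the same size: for the two change-of-basis matrices A and B,
-- D·1 = tr(BA) = tr(AB) = d·1 in k, and this is where characteristic zero is used.

module Submission where

open import Defs
open import Level using (Level)
open import Data.Nat using (ℕ; _<_)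
open import Function.Bundles using (_⇔_; mk⇔)
open import Relation.Binary.PropositionalEquality using (subst)
open import Data.Product using (_,_)

module Arithmetic where

  open import Data.Nat
    using (ℕ; zero; suc; _+_; _*_; _^_; _∸_; _⊓_; _≤_; _<_; _≤?_; _≡ᵇ_; _!; z≤n; s≤s; s≤s⁻¹;
           NonZero; nonTrivial⇒≢1; nonTrivial⇒n>1)
  open import Data.Nat.Properties
  open import Data.Nat.Divisibility
  open import Data.Nat.DivMod
  open import Data.Nat.Primality
  open import Data.Nat.Induction using (<-wellFounded)
  open import Data.Nat.Primality.Factorisation using (factorise)
  open import Data.Nat.ListAction using (product)
  open import Data.Nat.Combinatorics using (k![n∸k]!∣n!)
  open import Data.List using (List; []; _∷_; map; upTo; applyUpTo)
  open import Data.List.Properties using (map-cong)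
  open import Data.Bool using (T; _∧_)
  open import Data.Bool.Properties using (T-∧)
  open import Data.List.Relation.Unary.All using (_∷_)
  open import Induction.WellFounded using (Acc; acc)
  open import Data.Product using (∃; _×_; _,_; proj₁; proj₂)
  open import Data.Sum using (inj₁; inj₂)
  open import Function.Bundles using (_⇔_; mk⇔; Equivalence)
  open import Relation.Nullary using (¬_; Dec; yes; no; contradiction)
  open import Relation.Nullary.Decidable using (dec-true; dec-false; map′; T?)
  open import Relation.Binary.PropositionalEquality
  open import Algebra.Properties.CommutativeSemigroup *-commutativeSemigroup
    using () renaming (interchange to *-interchange)
  open import Algebra.Properties.CommutativeSemigroup +-commutativeSemigroup
    using () renaming (interchange to +-interchange)

  indicator : ∀ {a} {A : Set a} → Dec A → ℕ
  indicator (yes _) = 1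
  indicator (no _)  = 0

  indicator-yes : ∀ {a} {A : Set a} (a? : Dec A) → A → indicator a? ≡ 1
  indicator-yes (yes _) _ = refl
  indicator-yes (no ¬x) x = contradiction x ¬x

  indicator-no : ∀ {a} {A : Set a} (a? : Dec A) → ¬ A → indicator a? ≡ 0
  indicator-no (yes x) ¬x = contradiction x ¬x
  indicator-no (no _)  _  = refl

  indicator-cong : ∀ {a b} {A : Set a} {B : Set b} (a? : Dec A) (b? : Dec B) →
                   A ⇔ B → indicator a? ≡ indicator b?
  indicator-cong (yes x) b? A⇔B = sym (indicator-yes b? (Equivalence.to A⇔B x))
  indicator-cong (no ¬x) b? A⇔B = sym (indicator-no b? (λ y → ¬x (Equivalence.from A⇔B y)))

  sumTo-cong : ∀ n {f g : ℕ → ℕ} → (∀ l → f l ≡ g l) → sumTo n f ≡ sumTo n g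
  sumTo-cong zero    f≗g = refl
  sumTo-cong (suc n) f≗g = cong₂ _+_ (sumTo-cong n f≗g) (f≗g (suc n))

  sumTo-distrib-+ : ∀ n (f g : ℕ → ℕ) → sumTo n (λ l → f l + g l) ≡ sumTo n f + sumTo n g
  sumTo-distrib-+ zero    f g = refl
  sumTo-distrib-+ (suc n) f g = trans (cong (_+ (f (suc n) + g (suc n))) (sumTo-distrib-+ n f g))
                                      (+-interchange (sumTo n f) (sumTo n g) (f (suc n)) (g (suc n)))

  sumTo-zero : ∀ n {f : ℕ → ℕ} → (∀ {l} → 1 ≤ l → l ≤ n → f l ≡ 0) → sumTo n f ≡ 0
  sumTo-zero zero    f≡0 = refl
  sumTo-zero (suc n) f≡0 =
    cong₂ _+_ (sumTo-zero n (λ 1≤l l≤n → f≡0 1≤l (m≤n⇒m≤1+n l≤n))) (f≡0 (s≤s z≤n) ≤-refl)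

  sumTo-indicator-≤ : ∀ j v → sumTo j (λ l → indicator (l ≤? v)) ≡ j ⊓ v
  sumTo-indicator-≤ zero    v = refl
  sumTo-indicator-≤ (suc j) v with suc j ≤? v
  ... | yes j<v = trans (cong (_+ 1) (trans (sumTo-indicator-≤ j v) (m≤n⇒m⊓n≡m (<⇒≤ j<v))))
                        (trans (+-comm j 1) (sym (m≤n⇒m⊓n≡m j<v)))
  ... | no  j≮v = trans (+-identityʳ _) (trans (sumTo-indicator-≤ j v)
                        (trans (m≥n⇒m⊓n≡n v≤j) (sym (m≥n⇒m⊓n≡n (m≤n⇒m≤1+n v≤j)))))
    where v≤j = s≤s⁻¹ (≰⇒> j≮v)

  n<m^n : ∀ {m} → 1 < m → ∀ n → n < m ^ n
  n<m^n 1<m zero    = s≤s z≤n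
  n<m^n {m@(suc _)} 1<m (suc n) =
    ≤-<-trans (n<m^n 1<m n) (subst (m ^ n <_) (*-comm (m ^ n) m) (m<m*n (m ^ n) m {{m^n≢0 m n}} 1<m))

  suc-/ : ∀ m n .{{_ : NonZero n}} → suc m / n ≡ m / n + indicator (n ∣? suc m)
  suc-/ m n with m≤n⇒m<n∨m≡n (m%n<n m n)
  ... | inj₁ 1+r<n = begin
    suc m / n              ≡⟨ cong (_/ n) 1+m≡1+r+kn ⟩
    (suc r + k * n) / n    ≡⟨ +-distrib-/-∣ʳ (suc r) (n∣m*n k) ⟩
    suc r / n + k * n / n  ≡⟨ cong₂ _+_ (m<n⇒m/n≡0 1+r<n) (m*n/n≡m k n) ⟩
    k                      ≡⟨ +-identityʳ k ⟨
    k + 0                  ≡⟨ cong (k +_) (indicator-no (n ∣? suc m) n∤1+m) ⟨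
    k + indicator (n ∣? suc m) ∎
    where
    open ≡-Reasoning
    r = m % n
    k = m / n
    1+m≡1+r+kn : suc m ≡ suc r + k * n
    1+m≡1+r+kn = cong suc (m≡m%n+[m/n]*n m n)
    n∤1+m : n ∤ suc m
    n∤1+m n∣1+m = 0≢1+n (begin
      0                      ≡⟨ n∣m⇒m%n≡0 (suc m) n n∣1+m ⟨
      suc m % n              ≡⟨ cong (_% n) 1+m≡1+r+kn ⟩
      (suc r + k * n) % n    ≡⟨ [m+kn]%n≡m%n (suc r) k n ⟩
      suc r % n              ≡⟨ m<n⇒m%n≡m 1+r<n ⟩
      suc r                  ∎)
  ... | inj₂ 1+r≡n = begin
    suc m / n                  ≡⟨ cong (_/ n) 1+m≡[1+k]n ⟩
    suc k * n / n              ≡⟨ m*n/n≡m (suc k) n ⟩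
    suc k                      ≡⟨ +-comm 1 k ⟩
    k + 1                      ≡⟨ cong (k +_) (indicator-yes (n ∣? suc m) (divides (suc k) 1+m≡[1+k]n)) ⟨
    k + indicator (n ∣? suc m) ∎
    where
    open ≡-Reasoning
    k = m / n
    1+m≡[1+k]n : suc m ≡ suc k * n
    1+m≡[1+k]n = trans (cong suc (m≡m%n+[m/n]*n m n)) (cong (_+ k * n) 1+r≡n)

  legendreSum : ∀ p .{{_ : NonZero p}} → ℕ → ℕ
  legendreSum p j = sumTo j (λ l → _/_ j (p ^ l) {{m^n≢0 p l}})

  xExp-prime : ∀ {p} (p-prime : Prime p) j → xExp p j ≡ legendreSum p {{prime⇒nonZero p-prime}} j
  xExp-prime {suc (suc r)} p-prime j rewrite dec-true (prime? (suc (suc r))) p-prime = refl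

  xExp-nonprime : ∀ {p} → ¬ Prime p → ∀ j → xExp p j ≡ 0
  xExp-nonprime {zero}        _ j = refl
  xExp-nonprime {suc zero}    _ j = refl
  xExp-nonprime {suc (suc r)} ¬p-prime j rewrite dec-false (prime? (suc (suc r))) ¬p-prime = refl

  xExp-small : ∀ {p j} → j < p → xExp p j ≡ 0
  xExp-small {p} {j} j<p with prime? p
  ... | no ¬p-prime = xExp-nonprime ¬p-prime j
  ... | yes p-prime = trans (xExp-prime p-prime j) (sumTo-zero j j/pˡ≡0)
    where
    instance
      p≢0 : NonZero p
      p≢0 = prime⇒nonZero p-prime
    j/pˡ≡0 : ∀ {l} → 1 ≤ l → l ≤ j → _/_ j (p ^ l) {{m^n≢0 p l}} ≡ 0
    j/pˡ≡0 {suc l} _ _ = m<n⇒m/n≡0 {{m^n≢0 p (suc l)}} (<-≤-trans j<p (m≤m*n p (p ^ l) {{m^n≢0 p l}}))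

  -- p-adic valuations and Legendre's formula

  record Valuation (p m e : ℕ) : Set where
    constructor valuation
    field
      pᵉ∣m   : p ^ e ∣ m
      pᵉ⁺¹∤m : p ^ suc e ∤ m

  ^-monoʳ-∣ : ∀ p {e e′} → e ≤ e′ → p ^ e ∣ p ^ e′
  ^-monoʳ-∣ p {e} {e′} e≤e′ = divides (p ^ (e′ ∸ e)) (begin
    p ^ e′                 ≡⟨ cong (p ^_) (m+[n∸m]≡n e≤e′) ⟨
    p ^ (e + (e′ ∸ e))     ≡⟨ ^-distribˡ-+-* p e (e′ ∸ e) ⟩
    p ^ e * p ^ (e′ ∸ e)   ≡⟨ *-comm (p ^ e) _ ⟩
    p ^ (e′ ∸ e) * p ^ e   ∎)
    where open ≡-Reasoning

  valuation-^∣⇔≤ : ∀ {p m e} → Valuation p m e → ∀ l → p ^ l ∣ m ⇔ l ≤ e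
  valuation-^∣⇔≤ {p} (valuation pᵉ∣m pᵉ⁺¹∤m) l = mk⇔
    (λ pˡ∣m → ≮⇒≥ (λ e<l → pᵉ⁺¹∤m (∣-trans (^-monoʳ-∣ p e<l) pˡ∣m)))
    (λ l≤e → ∣-trans (^-monoʳ-∣ p l≤e) pᵉ∣m)

  valuation-∣⇔>0 : ∀ {p m e} → Valuation p m e → p ∣ m ⇔ 0 < e
  valuation-∣⇔>0 {p} v = mk⇔
    (λ p∣m → Equivalence.to (valuation-^∣⇔≤ v 1) (∣-trans (∣-reflexive (*-identityʳ p)) p∣m))
    (λ 0<e → m*n∣⇒m∣ p 1 (Equivalence.from (valuation-^∣⇔≤ v 1) 0<e))

  valuation-unique : ∀ {p m e e′} → Valuation p m e → Valuation p m e′ → e ≡ e′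
  valuation-unique v v′ = ≤-antisym (Equivalence.to (valuation-^∣⇔≤ v′ _) (Valuation.pᵉ∣m v))
                                    (Equivalence.to (valuation-^∣⇔≤ v _) (Valuation.pᵉ∣m v′))

  module _ {p : ℕ} (p-prime : Prime p) where

    private instance
      p≢0 : NonZero p
      p≢0 = prime⇒nonZero p-prime

    p>1 : 1 < p
    p>1 = nonTrivial⇒n>1 p {{prime⇒nonTrivial p-prime}}

    p∤1 : p ∤ 1
    p∤1 p∣1 = nonTrivial⇒≢1 {{prime⇒nonTrivial p-prime}} (∣1⇒≡1 p∣1)

    valuation-0 : ∀ {m} → p ∤ m → Valuation p m 0
    valuation-0 {m} p∤m = valuation (1∣ m) λ p∣m → p∤m (m*n∣⇒m∣ p 1 p∣m)

    valuation-intro : ∀ {m} e → p ∤ m → Valuation p (m * p ^ e) e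
    valuation-intro {m} e p∤m =
      valuation (n∣m*n m) λ pᵉ⁺¹∣mpᵉ → p∤m (*-cancelʳ-∣ (p ^ e) {{m^n≢0 p e}} pᵉ⁺¹∣mpᵉ)

    valuation-* : ∀ {x y e f} → Valuation p x e → Valuation p y f → Valuation p (x * y) (e + f)
    valuation-* {e = e} {f} (valuation (divides-refl x′) pᵉ⁺¹∤x) (valuation (divides-refl y′) pᶠ⁺¹∤y) =
      subst (λ z → Valuation p z (e + f)) (sym xy≡x′y′pᵉ⁺ᶠ) (valuation-intro (e + f) p∤x′y′)
      where
      p∤x′y′ : p ∤ x′ * y′
      p∤x′y′ p∣x′y′ with euclidsLemma x′ y′ p-prime p∣x′y′
      ... | inj₁ p∣x′ = pᵉ⁺¹∤x (*-monoˡ-∣ (p ^ e) p∣x′)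
      ... | inj₂ p∣y′ = pᶠ⁺¹∤y (*-monoˡ-∣ (p ^ f) p∣y′)
      xy≡x′y′pᵉ⁺ᶠ : x′ * p ^ e * (y′ * p ^ f) ≡ x′ * y′ * p ^ (e + f)
      xy≡x′y′pᵉ⁺ᶠ = trans (*-interchange x′ (p ^ e) y′ (p ^ f)) (cong (x′ * y′ *_) (sym (^-distribˡ-+-* p e f)))

    valuation-1 : Valuation p 1 0
    valuation-1 = valuation-0 p∤1

    valuation-self : Valuation p p 1
    valuation-self = subst (λ z → Valuation p z 1) (trans (*-identityˡ (p * 1)) (*-identityʳ p)) (valuation-intro 1 p∤1)

    valuation-^ : ∀ {x e} → Valuation p x e → ∀ k → Valuation p (x ^ k) (k * e)
    valuation-^ v zero    = valuation-1
    valuation-^ v (suc k) = valuation-* v (valuation-^ v k)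

    valuation-prodTo : ∀ {f g : ℕ → ℕ} → (∀ j → Valuation p (f j) (g j)) →
                       ∀ n → Valuation p (prodTo n f) (sumTo n g)
    valuation-prodTo v zero    = valuation-1
    valuation-prodTo v (suc n) = valuation-* (valuation-prodTo v n) (v (suc n))

    valuation-exists : ∀ m .{{_ : NonZero m}} → ∃ (Valuation p m)
    valuation-exists m = go m (<-wellFounded m)
      where
      go : ∀ m .{{_ : NonZero m}} → Acc _<_ m → ∃ (Valuation p m)
      go m (acc rec) with p ∣? m
      ... | no  p∤m = 0 , valuation-0 p∤m
      ... | yes (divides-refl q) = suc e , subst (Valuation p (q * p)) (+-comm e 1) (valuation-* vq valuation-self)
        where
        instance
          q≢0 : NonZero q
          q≢0 = m*n≢0⇒m≢0 q
        e,vq = go q (rec (m<m*n q p p>1))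
        e = proj₁ e,vq
        vq = proj₂ e,vq

    -- ⌊(j+1)/pˡ⌋ = ⌊j/pˡ⌋ + [pˡ ∣ j+1], and pˡ ∣ j+1 exactly for l ≤ v.
    xExp-suc : ∀ {j v} → Valuation p (suc j) v → xExp p (suc j) ≡ v + xExp p j
    xExp-suc {j} {v} v₁₊ⱼ = begin
      xExp p (suc j)
        ≡⟨ xExp-prime p-prime (suc j) ⟩
      sumTo j (λ l → _/_ (suc j) (p ^ l) {{m^n≢0 p l}}) + _/_ (suc j) (p ^ suc j) {{m^n≢0 p (suc j)}}
        ≡⟨ cong₂ _+_ (sumTo-cong j (λ l → suc-/ j (p ^ l) {{m^n≢0 p l}}))
                     (m<n⇒m/n≡0 {{m^n≢0 p (suc j)}} (n<m^n p>1 (suc j))) ⟩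
      sumTo j (λ l → _/_ j (p ^ l) {{m^n≢0 p l}} + indicator (p ^ l ∣? suc j)) + 0
        ≡⟨ trans (+-identityʳ _) (sumTo-distrib-+ j _ _) ⟩
      legendreSum p j + sumTo j (λ l → indicator (p ^ l ∣? suc j))
        ≡⟨ cong₂ _+_ (sym (xExp-prime p-prime j))
                     (sumTo-cong j (λ l → indicator-cong (p ^ l ∣? suc j) (l ≤? v) (valuation-^∣⇔≤ v₁₊ⱼ l))) ⟩
      xExp p j + sumTo j (λ l → indicator (l ≤? v))
        ≡⟨ cong (xExp p j +_) (trans (sumTo-indicator-≤ j v) (m≥n⇒m⊓n≡n v≤j)) ⟩
      xExp p j + v
        ≡⟨ +-comm (xExp p j) v ⟩
      v + xExp p j ∎
      where
      open ≡-Reasoning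
      v≤j : v ≤ j
      v≤j = s≤s⁻¹ (<-≤-trans (n<m^n p>1 v) (∣⇒≤ (Valuation.pᵉ∣m v₁₊ⱼ)))

    valuation-! : ∀ j → Valuation p (j !) (xExp p j)
    valuation-! zero    = subst (Valuation p 1) (sym (xExp-prime p-prime 0)) valuation-1
    valuation-! (suc j) = subst (Valuation p (suc j !)) (sym (xExp-suc vⱼ₊₁)) (valuation-* vⱼ₊₁ (valuation-! j))
      where vⱼ₊₁ = proj₂ (valuation-exists (suc j))

  prime-factor : ∀ m .{{_ : NonZero m}} → m ≢ 1 → ∃ λ p → Prime p × p ∣ m
  prime-factor m m≢1 with factorise m
  ... | record { factors = [] ; isFactorisation = m≡1 } = contradiction m≡1 m≢1
  ... | record { factors = p ∷ ps ; isFactorisation = m≡p*ps ; factorsPrime = p-prime ∷ _ } =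
    p , p-prime , divides (product ps) (trans m≡p*ps (*-comm p (product ps)))

  Valuations-⊆ : ℕ → ℕ → Set
  Valuations-⊆ x y = ∀ {p e} → Prime p → Valuation p x e → Valuation p y e

  valuations-⊆-cancel : ∀ {p x y} .{{_ : NonZero y}} → Prime p →
                        Valuations-⊆ (x * p) (y * p) → Valuations-⊆ x y
  valuations-⊆-cancel {p} {x} {y} p-prime xp⊆yp {q} {e} q-prime vx =
    subst (Valuation q y) (+-cancelʳ-≡ g f e (valuation-unique vyp (xp⊆yp q-prime vxp))) vy
    where
    instance
      p≢0 : NonZero p
      p≢0 = prime⇒nonZero p-prime
    g = proj₁ (valuation-exists q-prime p)
    vp = proj₂ (valuation-exists q-prime p)
    f = proj₁ (valuation-exists q-prime y)
    vy = proj₂ (valuation-exists q-prime y)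
    vxp = valuation-* q-prime vx vp
    vyp = valuation-* q-prime vy vp

  valuations-⊆-∣ : ∀ {p x y} .{{_ : NonZero x}} → Prime p → Valuations-⊆ x y → p ∣ x → p ∣ y
  valuations-⊆-∣ {x = x} p-prime x⊆y p∣x =
    Equivalence.from (valuation-∣⇔>0 (x⊆y p-prime vx)) (Equivalence.to (valuation-∣⇔>0 vx) p∣x)
    where vx = proj₂ (valuation-exists p-prime x)

  -- Induction on x: a prime factor of x also divides y, and cancelling it preserves the hypothesis.
  ≡-by-valuations : ∀ x y .{{_ : NonZero x}} .{{_ : NonZero y}} → Valuations-⊆ x y → x ≡ y
  ≡-by-valuations x y = go x y (<-wellFounded x)
    where
    go : ∀ x y .{{_ : NonZero x}} .{{_ : NonZero y}} → Acc _<_ x → Valuations-⊆ x y → x ≡ y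
    go x y (acc rec) x⊆y with x ≟ 1 | y ≟ 1
    ... | yes x≡1 | yes y≡1 = trans x≡1 (sym y≡1)
    ... | yes refl | no y≢1 with prime-factor y y≢1
    ...   | p , p-prime , p∣y =
      contradiction (Equivalence.to (valuation-∣⇔>0 (x⊆y p-prime (valuation-1 p-prime))) p∣y) (<-irrefl refl)
    go x y (acc rec) x⊆y | no x≢1 | _ with prime-factor x x≢1
    ... | p , p-prime , divides-refl x′ with valuations-⊆-∣ p-prime x⊆y (n∣m*n x′)
    ...   | divides-refl y′ = cong (_* p) (go x′ y′ (rec x′<x) (valuations-⊆-cancel p-prime x⊆y))
      where
      instance
        x′≢0 : NonZero x′
        x′≢0 = m*n≢0⇒m≢0 x′
        y′≢0 : NonZero y′
        y′≢0 = m*n≢0⇒m≢0 y′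
      x′<x : x′ < x′ * p
      x′<x = m<m*n x′ p (p>1 p-prime)

  hExp : ℕ → (ℕ → ℕ) → ℕ → ℕ
  hExp n a p = sumTo n (λ j → a j * xExp p j)

  hExp-large : ∀ {p} n a → n < p → hExp n a p ≡ 0
  hExp-large n a n<p = sumTo-zero n λ {j} _ j≤n →
    trans (cong (a j *_) (xExp-small (≤-<-trans j≤n n<p))) (*-zeroʳ (a j))

  factProd-nonZero : ∀ n a → NonZero (factProd n a)
  factProd-nonZero zero    a = _
  factProd-nonZero (suc n) a = m*n≢0 (factProd n a) ((suc n !) ^ a (suc n))
                                 {{factProd-nonZero n a}} {{m^n≢0 (suc n !) (a (suc n)) {{suc n !≢0}}}}

  valuation-factProd : ∀ {p} → Prime p → ∀ n a → Valuation p (factProd n a) (hExp n a p)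
  valuation-factProd p-prime n a =
    valuation-prodTo p-prime (λ j → valuation-^ p-prime (valuation-! p-prime j) (a j)) n

  hExp-nonprime : ∀ {p} n a → ¬ Prime p → hExp n a p ≡ 0
  hExp-nonprime n a ¬p-prime = sumTo-zero n λ {j} _ _ →
    trans (cong (a j *_) (xExp-nonprime ¬p-prime j)) (*-zeroʳ (a j))

  factProd-≡⇔hExp-≡ : ∀ n a b → factProd n a ≡ factProd n b ⇔ (∀ p → hExp n a p ≡ hExp n b p)
  factProd-≡⇔hExp-≡ n a b = mk⇔ hExp-≡ factProd-≡
    where
    hExp-≡ : factProd n a ≡ factProd n b → ∀ p → hExp n a p ≡ hExp n b p
    hExp-≡ Fa≡Fb p with prime? p
    ... | yes p-prime = valuation-unique (valuation-factProd p-prime n a)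
                          (subst (λ x → Valuation p x (hExp n b p)) (sym Fa≡Fb) (valuation-factProd p-prime n b))
    ... | no ¬p-prime = trans (hExp-nonprime n a ¬p-prime) (sym (hExp-nonprime n b ¬p-prime))
    factProd-≡ : (∀ p → hExp n a p ≡ hExp n b p) → factProd n a ≡ factProd n b
    factProd-≡ hExpa≡hExpb = ≡-by-valuations _ _ {{factProd-nonZero n a}} {{factProd-nonZero n b}}
      λ {p} p-prime va → subst (Valuation p (factProd n b))
        (sym (trans (valuation-unique va (valuation-factProd p-prime n a)) (hExpa≡hExpb p)))
        (valuation-factProd p-prime n b)

  !*!∣! : ∀ s t → s ! * t ! ∣ (s + t) !
  !*!∣! s t = subst (λ u → s ! * u ! ∣ (s + t) !) (m+n∸m≡n s t) (k![n∸k]!∣n! (m≤m+n s t))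

  !^∣! : ∀ j k → (j !) ^ k ∣ (k * j) !
  !^∣! j zero    = ∣-refl
  !^∣! j (suc k) = ∣-trans (*-monoʳ-∣ (j !) (!^∣! j k)) (!*!∣! j (k * j))

  factProd-∣-! : ∀ n a → factProd n a ∣ (sumTo n (λ j → j * a j)) !
  factProd-∣-! zero    a = ∣-refl
  factProd-∣-! (suc n) a = ∣-trans
    (*-pres-∣ (factProd-∣-! n a)
              (subst (λ m → (suc n !) ^ a (suc n) ∣ m !) (*-comm (a (suc n)) (suc n)) (!^∣! (suc n) (a (suc n)))))
    (!*!∣! (sumTo n (λ j → j * a j)) (suc n * a (suc n)))

  -- Monomials of k[x,q]

  expAt : List ℕ → ℕ → ℕ
  expAt []       i       = 0
  expAt (x ∷ xs) zero    = x
  expAt (x ∷ xs) (suc i) = expAt xs i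

  infix 4 _≈ₘ_
  record _≈ₘ_ (m m′ : XMon) : Set where
    constructor mk≈ₘ
    field
      qexp-≡  : XMon.qexp m ≡ XMon.qexp m′
      xexps-≗ : ∀ i → expAt (XMon.xexps m) i ≡ expAt (XMon.xexps m′) i

  ≈ₘ-refl : ∀ {m} → m ≈ₘ m
  ≈ₘ-refl = mk≈ₘ refl λ _ → refl

  ≈ₘ-sym : ∀ {m m′} → m ≈ₘ m′ → m′ ≈ₘ m
  ≈ₘ-sym (mk≈ₘ q≡q′ xs≗xs′) = mk≈ₘ (sym q≡q′) λ i → sym (xs≗xs′ i)

  ≈ₘ-trans : ∀ {m m′ m″} → m ≈ₘ m′ → m′ ≈ₘ m″ → m ≈ₘ m″
  ≈ₘ-trans (mk≈ₘ q≡q′ xs≗xs′) (mk≈ₘ q′≡q″ xs′≗xs″) =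
    mk≈ₘ (trans q≡q′ q′≡q″) λ i → trans (xs≗xs′ i) (xs′≗xs″ i)

  T-allZero : ∀ xs → T (allZero xs) ⇔ (∀ i → expAt xs i ≡ 0)
  T-allZero []       = mk⇔ (λ _ _ → refl) _
  T-allZero (x ∷ xs) = mk⇔ to from
    where
    to : T (isZero x ∧ allZero xs) → ∀ i → expAt (x ∷ xs) i ≡ 0
    to t zero    = ≡ᵇ⇒≡ x 0 (proj₁ (Equivalence.to T-∧ t))
    to t (suc i) = Equivalence.to (T-allZero xs) (proj₂ (Equivalence.to T-∧ t)) i
    from : (∀ i → expAt (x ∷ xs) i ≡ 0) → T (isZero x ∧ allZero xs)
    from x∷xs≗0 = Equivalence.from T-∧
      (≡⇒≡ᵇ x 0 (x∷xs≗0 zero) , Equivalence.from (T-allZero xs) (λ i → x∷xs≗0 (suc i)))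

  T-eqExps : ∀ xs ys → T (eqExps xs ys) ⇔ (∀ i → expAt xs i ≡ expAt ys i)
  T-eqExps [] ys = mk⇔ (λ t i → sym (Equivalence.to (T-allZero ys) t i))
                       (λ []≗ys → Equivalence.from (T-allZero ys) (λ i → sym ([]≗ys i)))
  T-eqExps (x ∷ xs) [] = T-allZero (x ∷ xs)
  T-eqExps (x ∷ xs) (y ∷ ys) = mk⇔ to from
    where
    to : T ((x ≡ᵇ y) ∧ eqExps xs ys) → ∀ i → expAt (x ∷ xs) i ≡ expAt (y ∷ ys) i
    to t zero    = ≡ᵇ⇒≡ x y (proj₁ (Equivalence.to T-∧ t))
    to t (suc i) = Equivalence.to (T-eqExps xs ys) (proj₂ (Equivalence.to T-∧ t)) i
    from : (∀ i → expAt (x ∷ xs) i ≡ expAt (y ∷ ys) i) → T ((x ≡ᵇ y) ∧ eqExps xs ys)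
    from x∷xs≗y∷ys = Equivalence.from T-∧
      (≡⇒≡ᵇ x y (x∷xs≗y∷ys zero) , Equivalence.from (T-eqExps xs ys) (λ i → x∷xs≗y∷ys (suc i)))

  T-eqMon : ∀ m m′ → T (eqMon m m′) ⇔ m ≈ₘ m′
  T-eqMon (xmon q xs) (xmon q′ xs′) = mk⇔
    (λ t → let (q≡ᵇq′ , xs≈xs′) = Equivalence.to T-∧ t in
           mk≈ₘ (≡ᵇ⇒≡ q q′ q≡ᵇq′) (Equivalence.to (T-eqExps xs xs′) xs≈xs′))
    (λ (mk≈ₘ q≡q′ xs≗xs′) → Equivalence.from T-∧
           (≡⇒≡ᵇ q q′ q≡q′ , Equivalence.from (T-eqExps xs xs′) xs≗xs′))

  infix 4 _≈ₘ?_
  _≈ₘ?_ : ∀ m m′ → Dec (m ≈ₘ m′)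
  m ≈ₘ? m′ = map′ (Equivalence.to (T-eqMon m m′)) (Equivalence.from (T-eqMon m m′)) (T? (eqMon m m′))

  expAt-map-applyUpTo : ∀ (f g : ℕ → ℕ) {k i} → i < k → expAt (map f (applyUpTo g k)) i ≡ f (g i)
  expAt-map-applyUpTo f g {suc k} {zero}  _         = refl
  expAt-map-applyUpTo f g {suc k} {suc i} (s≤s i<k) = expAt-map-applyUpTo f (λ j → g (suc j)) i<k

  hMon-≈ₘ⇔factProd-≡ : ∀ {S n} (a b : Comp S n) →
                       hMon n (proj₁ a) ≈ₘ hMon n (proj₁ b) ⇔ factProd n (proj₁ a) ≡ factProd n (proj₁ b)
  hMon-≈ₘ⇔factProd-≡ {n = n} (a , _ , _ , deg-a) (b , _ , _ , deg-b) = mk⇔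
    (λ a≈b → Equivalence.from (factProd-≡⇔hExp-≡ n a b) (hExp-≡ (_≈ₘ_.xexps-≗ a≈b)))
    (λ Fa≡Fb → mk≈ₘ (trans deg-a (sym deg-b))
               λ i → cong (λ xs → expAt xs i) (map-cong (Equivalence.to (factProd-≡⇔hExp-≡ n a b) Fa≡Fb) (upTo (suc n))))
    where
    hExp-≡ : (∀ i → expAt (XMon.xexps (hMon n a)) i ≡ expAt (XMon.xexps (hMon n b)) i) → ∀ p → hExp n a p ≡ hExp n b p
    hExp-≡ xs≗ p with p ≤? n
    ... | yes p≤n = begin
      hExp n a p                            ≡⟨ expAt-map-applyUpTo (hExp n a) (λ i → i) (s≤s p≤n) ⟨
      expAt (XMon.xexps (hMon n a)) p       ≡⟨ xs≗ p ⟩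
      expAt (XMon.xexps (hMon n b)) p       ≡⟨ expAt-map-applyUpTo (hExp n b) (λ i → i) (s≤s p≤n) ⟩
      hExp n b p                            ∎
      where open ≡-Reasoning
    ... | no p≰n = trans (hExp-large n a (≰⇒> p≰n)) (sym (hExp-large n b (≰⇒> p≰n)))

  cofactor-≡⇔ : ∀ {x y x′ y′ z} → NonZero z → x * y ≡ z → x′ * y′ ≡ z → x ≡ x′ ⇔ y ≡ y′
  cofactor-≡⇔ {x} {y} {x′} {y′} z≢0 xy≡z x′y′≡z = mk⇔
    (λ { refl → *-cancelˡ-≡ y y′ x {{m*n≢0⇒m≢0 x {{xy≢0}}}} xy≡x′y′ })
    (λ { refl → *-cancelʳ-≡ x x′ y {{m*n≢0⇒n≢0 x {{xy≢0}}}} xy≡x′y′ })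
    where
    xy≢0 : NonZero (x * y)
    xy≢0 = subst NonZero (sym xy≡z) z≢0
    xy≡x′y′ : x * y ≡ x′ * y′
    xy≡x′y′ = trans xy≡z (sym x′y′≡z)

  multinomial : ∀ {S n} → Comp S n → ℕ
  multinomial {n = n} (a , _) = _/_ (n !) (factProd n a) {{factProd-nonZero n a}}

  multinomial-MultVal : ∀ {S n} (a : Comp S n) → MultVal S n (multinomial a)
  multinomial-MultVal {n = n} a@(a′ , _ , _ , deg-a) = a , m/n*n≡m {{factProd-nonZero n a′}}
    (subst (λ m → factProd n a′ ∣ m !) deg-a (factProd-∣-! n a′))

  MultVal-≡⇔hMon-≈ₘ : ∀ {S n c c′} (u : MultVal S n c) (v : MultVal S n c′) →
                      c ≡ c′ ⇔ hMon n (proj₁ (proj₁ u)) ≈ₘ hMon n (proj₁ (proj₁ v))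
  MultVal-≡⇔hMon-≈ₘ {n = n} (a , ca≡n!) (b , c′b≡n!) = mk⇔
    (λ c≡c′ → Equivalence.from (hMon-≈ₘ⇔factProd-≡ a b) (Equivalence.to c≡c′⇔Fa≡Fb c≡c′))
    (λ a≈b → Equivalence.from c≡c′⇔Fa≡Fb (Equivalence.to (hMon-≈ₘ⇔factProd-≡ a b) a≈b))
    where c≡c′⇔Fa≡Fb = cofactor-≡⇔ (n !≢0) ca≡n! c′b≡n!

module LinearAlgebra {c ℓ} (K : Field c ℓ) where

  open import Level using (_⊔_)
  open import Data.Nat as ℕ using (ℕ; zero; suc)
  import Data.Nat.Properties as ℕ
  open import Data.Fin as Fin using (Fin; zero; suc; punchIn)
  open import Data.Fin.Properties using (punchInᵢ≢i)
  open import Function using (_∘_)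
  open import Data.List using ([]; _∷_; _++_; map; concat; tabulate)
  open import Data.Product using (Σ; _,_; proj₁; proj₂)
  open import Data.Bool using (true; false; if_then_else_)
  open import Relation.Binary using (tri<; tri≈; tri>)
  open import Relation.Binary.PropositionalEquality as ≡ using (_≡_; _≢_)
  open import Relation.Nullary using (¬_; does; contradiction)
  open import Relation.Nullary.Decidable using (dec-true; dec-false)

  open Field K hiding (zero)
  open import Algebra.Properties.Ring ring
    using (-‿+-comm; -0#≈0#; -‿distribˡ-*; +-identityʳ-unique; x∙y⁻¹≈ε⇒x≈y; x≈y⇒x∙y⁻¹≈ε)
  open import Algebra.Properties.Semiring.Sum semiring
  open import Relation.Binary.Reasoning.Setoid setoid

  sum-neg : ∀ {d} (f : Fin d → Carrier) → ∑[ i < d ] (- f i) ≈ - sum f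
  sum-neg {zero}  f = sym -0#≈0#
  sum-neg {suc d} f = trans (+-congˡ (sum-neg (λ i → f (suc i)))) (-‿+-comm (f zero) _)

  sum-δ : ∀ {d} (f : Fin d → Carrier) i → (∀ j → j ≢ i → f j ≈ 0#) → sum f ≈ f i
  sum-δ {suc d} f i f≈0 = begin
    sum f                     ≈⟨ sum-remove f ⟩
    f i + sum (f ∘ punchIn i) ≈⟨ +-congˡ (trans (sum-cong-≋ (λ j → f≈0 _ (punchInᵢ≢i i j)))
                                               (sum-replicate-zero d)) ⟩
    f i + 0#                  ≈⟨ +-identityʳ (f i) ⟩
    f i                       ∎

  sum-1# : ∀ d → ∑[ i < d ] 1# ≈ natK K d
  sum-1# zero    = refl
  sum-1# (suc d) = +-congˡ (sum-1# d)

  natK-+ : ∀ a b → natK K (a ℕ.+ b) ≈ natK K a + natK K b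
  natK-+ zero    b = sym (+-identityˡ _)
  natK-+ (suc a) b = trans (+-congˡ (natK-+ a b)) (sym (+-assoc 1# _ _))

  natK-cancelˡ : ∀ a d → natK K (a ℕ.+ d) ≈ natK K a → natK K d ≈ 0#
  natK-cancelˡ a d a+d≈a = +-identityʳ-unique (natK K a) (natK K d) (trans (sym (natK-+ a d)) a+d≈a)

  <⇒natK-≉ : CharZero K → ∀ {a b} → a ℕ.< b → ¬ (natK K b ≈ natK K a)
  <⇒natK-≉ char0 {a} a<b b≈a with ℕ.m≤n⇒∃[o]m+o≡n a<b
  ... | k , ≡.refl = char0 k (natK-cancelˡ a (suc k) (trans (reflexive (≡.cong (natK K) (ℕ.+-suc a k))) b≈a))

  natK-injective : CharZero K → ∀ a b → natK K a ≈ natK K b → a ≡ b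
  natK-injective char0 a b a≈b with ℕ.<-cmp a b
  ... | tri< a<b _ _ = contradiction (sym a≈b) (<⇒natK-≉ char0 a<b)
  ... | tri≈ _ a≡b _ = a≡b
  ... | tri> _ _ b<a = contradiction a≈b (<⇒natK-≉ char0 b<a)

  infix 4 _≈ₚ_
  _≈ₚ_ : Poly K → Poly K → Set ℓ
  f ≈ₚ g = _≈P_ K f g

  coeff-++ : ∀ f g m → coeff K (f ++ g) m ≈ coeff K f m + coeff K g m
  coeff-++ []             g m = sym (+-identityˡ _)
  coeff-++ ((x , m′) ∷ f) g m = trans (+-congˡ (coeff-++ f g m)) (sym (+-assoc _ _ _))

  coeff-scale : ∀ x f m → coeff K (scale K x f) m ≈ x * coeff K f m
  coeff-scale x []             m = sym (zeroʳ x)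
  coeff-scale x ((y , m′) ∷ f) m with eqMon m′ m
  ... | true  = trans (+-congˡ (coeff-scale x f m)) (sym (distribˡ x y _))
  ... | false = trans (+-cong (sym (zeroʳ x)) (coeff-scale x f m)) (sym (distribˡ x 0# _))

  coeff-concat-map-tabulate : ∀ {A : Set} {d} (g : A → Poly K) (f : Fin d → A) m →
                              coeff K (concat (map g (tabulate f))) m ≈ ∑[ i < d ] coeff K (g (f i)) m
  coeff-concat-map-tabulate {d = zero}  g f m = refl
  coeff-concat-map-tabulate {d = suc d} g f m =
    trans (coeff-++ (g (f zero)) _ m) (+-congˡ (coeff-concat-map-tabulate g (λ i → f (suc i)) m))

  coeff-lincomb : ∀ {d} cs (bs : Fin d → Poly K) m →
                  coeff K (lincomb K cs bs) m ≈ ∑[ i < d ] (cs i * coeff K (bs i) m)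
  coeff-lincomb cs bs m = trans (coeff-concat-map-tabulate (λ i → scale K (cs i) (bs i)) (λ i → i) m)
                                (sum-cong-≋ (λ i → coeff-scale (cs i) (bs i) m))

  InSpan : ∀ {d} → (Fin d → Poly K) → Poly K → Set (c ⊔ ℓ)
  InSpan {d} bs f = Σ (Fin d → Carrier) λ cs → lincomb K cs bs ≈ₚ f

  δ : ∀ {d} → Fin d → Fin d → Carrier
  δ i j = if does (j Fin.≟ i) then 1# else 0#

  δ-diag : ∀ {d} (i : Fin d) → δ i i ≈ 1#
  δ-diag i = reflexive (≡.cong (if_then 1# else 0#) (dec-true (i Fin.≟ i) ≡.refl))

  δ-off : ∀ {d} {i j : Fin d} → j ≢ i → δ i j ≈ 0#
  δ-off {i = i} {j} j≢i = reflexive (≡.cong (if_then 1# else 0#) (dec-false (j Fin.≟ i) j≢i))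

  lincomb-δ : ∀ {d} (bs : Fin d → Poly K) i → lincomb K (δ i) bs ≈ₚ bs i
  lincomb-δ bs i m = begin
    coeff K (lincomb K (δ i) bs) m         ≈⟨ coeff-lincomb (δ i) bs m ⟩
    ∑[ j < _ ] (δ i j * coeff K (bs j) m)  ≈⟨ sum-δ (λ j → δ i j * coeff K (bs j) m) i
                                                     (λ j j≢i → trans (*-congʳ (δ-off j≢i)) (zeroˡ _)) ⟩
    δ i i * coeff K (bs i) m               ≈⟨ trans (*-congʳ (δ-diag i)) (*-identityˡ _) ⟩
    coeff K (bs i) m                       ∎

  lincomb-unique : ∀ {d} {bs : Fin d → Poly K} → LinIndep K bs →
                   ∀ {cs cs′} → lincomb K cs bs ≈ₚ lincomb K cs′ bs → ∀ i → cs i ≈ cs′ i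
  lincomb-unique {d} {bs} indep {cs} {cs′} cs≈cs′ i =
    x∙y⁻¹≈ε⇒x≈y _ _ (indep (λ j → cs j + - cs′ j) difference≈0 i)
    where
    difference≈0 : lincomb K (λ j → cs j + - cs′ j) bs ≈ₚ zeroP K
    difference≈0 m = begin
      coeff K (lincomb K (λ j → cs j + - cs′ j) bs) m
        ≈⟨ coeff-lincomb (λ j → cs j + - cs′ j) bs m ⟩
      ∑[ j < d ] ((cs j + - cs′ j) * coeff K (bs j) m)
        ≈⟨ sum-cong-≋ (λ j → trans (distribʳ (coeff K (bs j) m) (cs j) (- cs′ j))
                                   (+-congˡ (sym (-‿distribˡ-* (cs′ j) (coeff K (bs j) m))))) ⟩
      ∑[ j < d ] (cs j * coeff K (bs j) m + - (cs′ j * coeff K (bs j) m))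
        ≈⟨ trans (∑-distrib-+ (λ j → cs j * coeff K (bs j) m) (λ j → - (cs′ j * coeff K (bs j) m)))
                 (+-congˡ (sum-neg (λ j → cs′ j * coeff K (bs j) m))) ⟩
      ∑[ j < d ] (cs j * coeff K (bs j) m) + - ∑[ j < d ] (cs′ j * coeff K (bs j) m)
        ≈⟨ x≈y⇒x∙y⁻¹≈ε (trans (sym (coeff-lincomb cs bs m)) (trans (cs≈cs′ m) (coeff-lincomb cs′ bs m))) ⟩
      0# ∎

  lincomb-compose : ∀ {d e} {es : Fin e → Poly K} {bs : Fin d → Poly K} (A : Fin d → Fin e → Carrier) →
                    (∀ i → lincomb K (A i) es ≈ₚ bs i) →
                    ∀ cs → lincomb K cs bs ≈ₚ lincomb K (λ l → ∑[ i < d ] (cs i * A i l)) es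
  lincomb-compose {d} {e} {es} {bs} A Aes≈bs cs m = begin
    coeff K (lincomb K cs bs) m
      ≈⟨ coeff-lincomb cs bs m ⟩
    ∑[ i < d ] (cs i * coeff K (bs i) m)
      ≈⟨ sum-cong-≋ (λ i → *-congˡ (trans (sym (Aes≈bs i m)) (coeff-lincomb (A i) es m))) ⟩
    ∑[ i < d ] (cs i * ∑[ l < e ] (A i l * coeff K (es l) m))
      ≈⟨ sum-cong-≋ (λ i → trans (*-distribˡ-sum (cs i) (λ l → A i l * coeff K (es l) m))
                                 (sum-cong-≋ (λ l → sym (*-assoc (cs i) (A i l) (coeff K (es l) m))))) ⟩
    ∑[ i < d ] ∑[ l < e ] (cs i * A i l * coeff K (es l) m)
      ≈⟨ ∑-comm (λ i l → cs i * A i l * coeff K (es l) m) ⟩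
    ∑[ l < e ] ∑[ i < d ] (cs i * A i l * coeff K (es l) m)
      ≈⟨ sum-cong-≋ (λ l → sym (*-distribʳ-sum (coeff K (es l) m) (λ i → cs i * A i l))) ⟩
    ∑[ l < e ] (∑[ i < d ] (cs i * A i l) * coeff K (es l) m)
      ≈⟨ coeff-lincomb (λ l → ∑[ i < d ] (cs i * A i l)) es m ⟨
    coeff K (lincomb K (λ l → ∑[ i < d ] (cs i * A i l)) es) m ∎

  change-of-basis-diagonal : ∀ {d e} {es : Fin e → Poly K} {bs : Fin d → Poly K} → LinIndep K es →
                             (A : Fin d → Fin e → Carrier) → (∀ i → lincomb K (A i) es ≈ₚ bs i) →
                             (B : Fin e → Fin d → Carrier) → (∀ k → lincomb K (B k) bs ≈ₚ es k) →
                             ∀ k → ∑[ i < d ] (B k i * A i k) ≈ 1#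
  change-of-basis-diagonal {es = es} es-indep A Aes≈bs B Bbs≈es k =
    trans (lincomb-unique es-indep BAes≈δes k) (δ-diag k)
    where
    BAes≈δes : lincomb K (λ l → ∑[ i < _ ] (B k i * A i l)) es ≈ₚ lincomb K (δ k) es
    BAes≈δes m = trans (sym (lincomb-compose A Aes≈bs (B k) m)) (trans (Bbs≈es k m) (sym (lincomb-δ es k m)))

  basis-size-unique : CharZero K → ∀ {d e} {es : Fin e → Poly K} {bs : Fin d → Poly K} →
                      LinIndep K es → LinIndep K bs →
                      (∀ k → InSpan bs (es k)) → (∀ i → InSpan es (bs i)) → e ≡ d
  basis-size-unique char0 {d} {e} {es} {bs} es-indep bs-indep es⊆⟨bs⟩ bs⊆⟨es⟩ = natK-injective char0 e d (begin
    natK K e                                ≈⟨ sum-1# e ⟨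
    ∑[ k < e ] 1#                           ≈⟨ sum-cong-≋ (λ k → sym (BA-diagonal k)) ⟩
    ∑[ k < e ] ∑[ i < d ] (B k i * A i k)   ≈⟨ ∑-comm (λ k i → B k i * A i k) ⟩
    ∑[ i < d ] ∑[ k < e ] (B k i * A i k)   ≈⟨ sum-cong-≋ (λ i → sum-cong-≋ (λ k → *-comm (B k i) (A i k))) ⟩
    ∑[ i < d ] ∑[ k < e ] (A i k * B k i)   ≈⟨ sum-cong-≋ AB-diagonal ⟩
    ∑[ i < d ] 1#                           ≈⟨ sum-1# d ⟩
    natK K d                                ∎)
    where
    A : Fin d → Fin e → Carrier
    A i = proj₁ (bs⊆⟨es⟩ i)
    Aes≈bs : ∀ i → lincomb K (A i) es ≈ₚ bs i
    Aes≈bs i = proj₂ (bs⊆⟨es⟩ i)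
    B : Fin e → Fin d → Carrier
    B k = proj₁ (es⊆⟨bs⟩ k)
    Bbs≈es : ∀ k → lincomb K (B k) bs ≈ₚ es k
    Bbs≈es k = proj₂ (es⊆⟨bs⟩ k)
    BA-diagonal : ∀ k → ∑[ i < d ] (B k i * A i k) ≈ 1#
    BA-diagonal = change-of-basis-diagonal es-indep A Aes≈bs B Bbs≈es
    AB-diagonal : ∀ i → ∑[ k < e ] (A i k * B k i) ≈ 1#
    AB-diagonal = change-of-basis-diagonal bs-indep B Bbs≈es A Aes≈bs


module MonomialBasis {c ℓ} (K : Field c ℓ) (S : ℕ → Set) (n : ℕ) where

  open import Data.Fin using (Fin; zero; suc)
  open import Data.Fin.Properties using () renaming (any? to anyFin?)
  open import Data.Product using (∃; _,_; proj₁; proj₂)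
  open import Data.Bool using (if_then_else_)
  open import Data.List using (List; []; _∷_; map; concat; tabulate; lookup; length; deduplicate)
  open import Data.List.Relation.Unary.All as All using (All; []; _∷_)
  open import Data.List.Relation.Unary.Unique.Propositional using (Unique)
  open import Data.List.Relation.Unary.AllPairs using (_∷_)
  open import Data.List.Membership.Propositional using (_∈_; find)
  open import Data.List.Membership.Propositional.Properties
    using (∈-lookup; ∈-map⁺; ∈-map⁻; ∈-deduplicate⁺; ∈-deduplicate⁻)
  open import Data.List.Relation.Unary.Any as Any using (any?)
  open import Data.List.Relation.Unary.Any.Properties using (lookup-index)
  import Data.List.Relation.Unary.All.Properties as AllP
  open import Data.List.Relation.Unary.All.Properties using (¬Any⇒All¬)
  open import Data.List.Relation.Unary.Unique.DecPropositional.Properties using (deduplicate-!)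
  import Data.Nat.Properties as ℕ
  open import Relation.Binary using (Setoid)
  open import Relation.Binary.PropositionalEquality using (_≡_; _≢_; refl; sym; trans; cong; subst)
  open import Relation.Nullary using (¬_; yes; no; contradiction)
  open import Relation.Nullary.Decidable using (dec-true; dec-false)
  open import Function.Bundles using (mk⇔; Equivalence)

  unique-lookup-injective : ∀ {A : Set} {xs : List A} → Unique xs → ∀ {i j} → lookup xs i ≡ lookup xs j → i ≡ j
  unique-lookup-injective (x∉xs ∷ _)         {zero}  {zero}  _  = refl
  unique-lookup-injective (x∉xs ∷ _)         {zero}  {suc j} eq = contradiction eq (All.lookup x∉xs (∈-lookup j))
  unique-lookup-injective (x∉xs ∷ _)         {suc i} {zero}  eq = contradiction (sym eq) (All.lookup x∉xs (∈-lookup i))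
  unique-lookup-injective (_ ∷ xs-unique)    {suc i} {suc j} eq = cong suc (unique-lookup-injective xs-unique eq)

  open Arithmetic
    using (_≈ₘ_; _≈ₘ?_; ≈ₘ-refl; ≈ₘ-sym; ≈ₘ-trans; multinomial; multinomial-MultVal; MultVal-≡⇔hMon-≈ₘ)
  open LinearAlgebra K
  open Field K hiding (zero; refl; sym; trans)
  open Setoid setoid using () renaming (refl to ≈-refl; sym to ≈-sym; trans to ≈-trans)
  open import Algebra.Properties.Semiring.Sum semiring using (sum-syntax; sum-cong-≋; sum-replicate-zero)
  open import Relation.Binary.Reasoning.Setoid setoid

  mon : Comp S n → XMon
  mon a = hMon n (proj₁ a)

  monomial : Comp S n → Poly K
  monomial a = h K ((1# , a) ∷ [])

  -- does (m′ ≈ₘ? m) reduces to eqMon m′ m, so dec-true and dec-false decide the test in coeff.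
  term-≈ : ∀ {m′ m} x → m′ ≈ₘ m → (if eqMon m′ m then x else 0#) ≡ x
  term-≈ {m′} {m} x m′≈m = cong (if_then x else 0#) (dec-true (m′ ≈ₘ? m) m′≈m)

  term-≉ : ∀ {m′ m} x → ¬ m′ ≈ₘ m → (if eqMon m′ m then x else 0#) ≡ 0#
  term-≉ {m′} {m} x m′≉m = cong (if_then x else 0#) (dec-false (m′ ≈ₘ? m) m′≉m)

  coeff-cong : ∀ f {m m′} → m ≈ₘ m′ → coeff K f m ≈ coeff K f m′
  coeff-cong []              m≈m′ = ≈-refl
  coeff-cong ((x , m″) ∷ f) {m} {m′} m≈m′ = +-cong (reflexive term≡term) (coeff-cong f m≈m′)
    where
    term≡term : (if eqMon m″ m then x else 0#) ≡ (if eqMon m″ m′ then x else 0#)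
    term≡term with m″ ≈ₘ? m
    ... | yes m″≈m = trans (term-≈ {m″} x m″≈m) (sym (term-≈ {m″} x (≈ₘ-trans m″≈m m≈m′)))
    ... | no  m″≉m = trans (term-≉ {m″} x m″≉m)
                           (sym (term-≉ {m″} {m′} x (λ m″≈m′ → m″≉m (≈ₘ-trans m″≈m′ (≈ₘ-sym m≈m′)))))

  coeff-h-≉ : ∀ (g : PolyS K S n) {m} → All (λ b → ¬ mon b ≈ₘ m) (map proj₂ g) → coeff K (h K g) m ≈ 0#
  coeff-h-≉ []            []            = ≈-refl
  coeff-h-≉ ((x , b) ∷ g) {m} (b≉m ∷ g≉m) =
    ≈-trans (+-cong (reflexive (term-≉ {mon b} {m} x b≉m)) (coeff-h-≉ g g≉m)) (+-identityˡ 0#)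

  coeff-monomial-≈ : ∀ a {m} → mon a ≈ₘ m → coeff K (monomial a) m ≈ 1#
  coeff-monomial-≈ a {m} a≈m = ≈-trans (+-identityʳ _) (reflexive (term-≈ {mon a} {m} 1# a≈m))

  coeff-monomial-≉ : ∀ a {m} → ¬ mon a ≈ₘ m → coeff K (monomial a) m ≈ 0#
  coeff-monomial-≉ a {m} a≉m = ≈-trans (+-identityʳ _) (reflexive (term-≉ {mon a} {m} 1# a≉m))

  monomial-inImage : ∀ a → InImage K S n (monomial a)
  monomial-inImage a = ((1# , a) ∷ []) , λ _ → ≈-refl

  spanning-coeff≉0 : ∀ {d} (bs : Fin d → Poly K) → (∀ f → InImage K S n f → InSpan bs f) →
                     ∀ a → ¬ (∀ i → coeff K (bs i) (mon a) ≈ 0#)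
  spanning-coeff≉0 {d} bs im⊆⟨bs⟩ a bs-vanish = 1≉0 (begin
    1#                                          ≈⟨ coeff-monomial-≈ a ≈ₘ-refl ⟨
    coeff K (monomial a) (mon a)                ≈⟨ cs·bs≈a (mon a) ⟨
    coeff K (lincomb K cs bs) (mon a)           ≈⟨ coeff-lincomb cs bs (mon a) ⟩
    ∑[ i < d ] (cs i * coeff K (bs i) (mon a))  ≈⟨ sum-cong-≋ (λ i → ≈-trans (*-congˡ (bs-vanish i)) (zeroʳ (cs i))) ⟩
    ∑[ i < d ] 0#                               ≈⟨ sum-replicate-zero d ⟩
    0#                                          ∎)
    where
    cs = proj₁ (im⊆⟨bs⟩ (monomial a) (monomial-inImage a))
    cs·bs≈a = proj₂ (im⊆⟨bs⟩ (monomial a) (monomial-inImage a))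

  record MonomialTransversal (D : ℕ) : Set where
    field
      rep            : Fin D → Comp S n
      rep-injective  : ∀ {i j} → mon (rep i) ≈ₘ mon (rep j) → i ≡ j
      rep-surjective : ∀ a → ∃ λ k → mon a ≈ₘ mon (rep k)

  module _ {D} (T : MonomialTransversal D) where

    open MonomialTransversal T

    basis : Fin D → Poly K
    basis k = monomial (rep k)

    basis-independent : LinIndep K basis
    basis-independent cs ∑cs·basis≈0 i = begin
      cs i                                                  ≈⟨ *-identityʳ (cs i) ⟨
      cs i * 1#                                             ≈⟨ *-congˡ (coeff-monomial-≈ (rep i) ≈ₘ-refl) ⟨
      cs i * coeff K (basis i) (mon (rep i))                ≈⟨ sum-δ (λ k → cs k * coeff K (basis k) (mon (rep i))) i off-diagonal ⟨
      ∑[ k < D ] (cs k * coeff K (basis k) (mon (rep i)))   ≈⟨ coeff-lincomb cs basis (mon (rep i)) ⟨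
      coeff K (lincomb K cs basis) (mon (rep i))            ≈⟨ ∑cs·basis≈0 (mon (rep i)) ⟩
      0#                                                    ∎
      where
      off-diagonal : ∀ k → k ≢ i → cs k * coeff K (basis k) (mon (rep i)) ≈ 0#
      off-diagonal k k≢i =
        ≈-trans (*-congˡ (coeff-monomial-≉ (rep k) (λ k≈i → k≢i (rep-injective k≈i)))) (zeroʳ (cs k))

    image-expansion : ∀ f → InImage K S n f → lincomb K (λ k → coeff K f (mon (rep k))) basis ≈ₚ f
    image-expansion f (g , hg≈f) m = ≈-trans (coeff-lincomb _ basis m) expansion
      where
      expansion : ∑[ k < D ] (coeff K f (mon (rep k)) * coeff K (basis k) m) ≈ coeff K f m
      expansion with anyFin? (λ k → mon (rep k) ≈ₘ? m)
      ... | yes (k₀ , k₀≈m) = begin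
        ∑[ k < D ] (coeff K f (mon (rep k)) * coeff K (basis k) m)  ≈⟨ sum-δ _ k₀ off-k₀ ⟩
        coeff K f (mon (rep k₀)) * coeff K (basis k₀) m             ≈⟨ *-congˡ (coeff-monomial-≈ (rep k₀) k₀≈m) ⟩
        coeff K f (mon (rep k₀)) * 1#                               ≈⟨ *-identityʳ _ ⟩
        coeff K f (mon (rep k₀))                                    ≈⟨ coeff-cong f k₀≈m ⟩
        coeff K f m                                                 ∎
        where
        off-k₀ : ∀ k → k ≢ k₀ → coeff K f (mon (rep k)) * coeff K (basis k) m ≈ 0#
        off-k₀ k k≢k₀ = ≈-trans (*-congˡ (coeff-monomial-≉ (rep k) (λ k≈m → k≢k₀ (rep-injective (≈ₘ-trans k≈m (≈ₘ-sym k₀≈m))))))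
                                (zeroʳ _)
      ... | no ∄k = begin
        ∑[ k < D ] (coeff K f (mon (rep k)) * coeff K (basis k) m)  ≈⟨ sum-cong-≋ (λ k → ≈-trans
                                                                         (*-congˡ (coeff-monomial-≉ (rep k) (λ k≈m → ∄k (k , k≈m))))
                                                                         (zeroʳ _)) ⟩
        ∑[ k < D ] 0#                                               ≈⟨ sum-replicate-zero D ⟩
        0#                                                          ≈⟨ coeff-h-≉ g (All.universal b≉m _) ⟨
        coeff K (h K g) m                                           ≈⟨ hg≈f m ⟩
        coeff K f m                                                 ∎
        where
        b≉m : ∀ b → ¬ mon b ≈ₘ m
        b≉m b b≈m = let (k , b≈k) = rep-surjective b in ∄k (k , ≈ₘ-trans (≈ₘ-sym b≈k) b≈m)

    transversal⇒dim : DimImage K S n D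
    transversal⇒dim = basis , (λ k → monomial-inImage (rep k)) , basis-independent , λ f f∈im → _ , image-expansion f f∈im

    dim-unique : CharZero K → ∀ {d} → DimImage K S n d → D ≡ d
    dim-unique char0 (bs , bs∈im , bs-independent , im⊆⟨bs⟩) =
      basis-size-unique char0 basis-independent bs-independent
        (λ k → im⊆⟨bs⟩ (basis k) (monomial-inImage (rep k))) (λ i → _ , image-expansion (bs i) (bs∈im i))

  mcount⇒transversal : ∀ {m} → MCount S n m → MonomialTransversal m
  mcount⇒transversal (L , refl , L-unique , L⇔MultVal) = record
    { rep            = λ k → proj₁ (val k)
    ; rep-injective  = λ {i} {j} i≈j →
        unique-lookup-injective L-unique (Equivalence.from (MultVal-≡⇔hMon-≈ₘ (val i) (val j)) i≈j)
    ; rep-surjective = rep-surjective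
    }
    where
    val : ∀ k → MultVal S n (lookup L k)
    val k = Equivalence.to (L⇔MultVal (lookup L k)) (∈-lookup k)
    rep-surjective : ∀ a → ∃ λ k → mon a ≈ₘ mon (proj₁ (val k))
    rep-surjective a = Any.index a∈L , Equivalence.to (MultVal-≡⇔hMon-≈ₘ (multinomial-MultVal a) (val _)) (lookup-index a∈L)
      where a∈L = Equivalence.from (L⇔MultVal (multinomial a)) (multinomial-MultVal a)

  -- Every multinomial coefficient already occurs among the monomials of the preimages of a basis:
  -- otherwise the corresponding monomial of h(k[S]_n) would have coefficient 0 in every basis vector.
  dim⇒mcount : ∀ {d} → DimImage K S n d → ∃ (MCount S n)
  dim⇒mcount {d} (bs , bs∈im , _ , im⊆⟨bs⟩) = length L , L , refl , deduplicate-! ℕ._≟_ values , L⇔MultVal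
    where
    comps : List (Comp S n)
    comps = concat (tabulate (λ i → map proj₂ (proj₁ (bs∈im i))))
    values : List ℕ
    values = map multinomial comps
    L : List ℕ
    L = deduplicate ℕ._≟_ values
    to : ∀ {c} → c ∈ L → MultVal S n c
    to c∈L with ∈-map⁻ multinomial (∈-deduplicate⁻ ℕ._≟_ values c∈L)
    ... | a , _ , refl = multinomial-MultVal a
    from : ∀ {c} → MultVal S n c → c ∈ L
    from (a , ca≡n!) with any? (λ b → mon b ≈ₘ? mon a) comps
    ... | no ∄b = contradiction bs-vanish (spanning-coeff≉0 bs im⊆⟨bs⟩ a)
      where
      bs-vanish : ∀ i → coeff K (bs i) (mon a) ≈ 0#
      bs-vanish i = ≈-trans (≈-sym (proj₂ (bs∈im i) (mon a)))
                            (coeff-h-≉ (proj₁ (bs∈im i)) (AllP.tabulate⁻ (AllP.concat⁻ (¬Any⇒All¬ comps ∄b)) i))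
    ... | yes ∃b with find ∃b
    ...   | b , b∈comps , b≈a = ∈-deduplicate⁺ ℕ._≟_ (subst (_∈ values) (sym c≡b) (∈-map⁺ multinomial b∈comps))
      where c≡b = Equivalence.from (MultVal-≡⇔hMon-≈ₘ (a , ca≡n!) (multinomial-MultVal b)) (≈ₘ-sym b≈a)
    L⇔MultVal : ∀ c → c ∈ L ⇔ MultVal S n c
    L⇔MultVal c = mk⇔ to from

lemma3 : ∀ {c ℓ : Level} (S : ℕ → Set) → (∀ j → S j → 0 < j) →
    (K : Field c ℓ) → CharZero K →
    ∀ n m → MCount S n m ⇔ DimImage K S n m
lemma3 S _ K char0 n m = mk⇔ (λ M → transversal⇒dim (mcount⇒transversal M)) from
  where
  open MonomialBasis K S n
  from : DimImage K S n m → MCount S n m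
  from dim with dim⇒mcount dim
  ... | D , M = subst (MCount S n) (dim-unique (mcount⇒transversal M) char0 dim) M
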